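{- Let $T$ be a finite labelled rooted tree and let $G=(V,E)$ be the directed multigraph whose vertex set is $V=\{[u]_\sim : u\in T\}$ and in which, for $p,q\in V$, the pair $(p,q)$ appears in $E$ with multiplicity equal to the largest $k\geq 0$ such that there exist a node $u\in T$ and distinct nodes $v_1,\dots,v_k\in\mathrm{children}(u)$ with $[u]_\sim=p$ and $[v_i]_\sim=q$ for all $1\leq i\leq k$. Then $G$ is a directed acyclic multigraph with a unique source (a unique vertex with no incoming edge).
   Context: A labelled rooted tree $T$ is a finite rooted tree (edges directed from parent to child; the root has no parent, every other node has exactly one parent), each node $u$ carrying a label $\overline{u}$; $\mathrm{attr}(T)=\{\overline{u}:u\in T\}$. $\mathrm{children}(u)$ is the set of children of $u$, and $T(u)$ is the labelled subtree made of $u$ and all its descendants. A tree isomorphism $\phi:T_1\to T_2$ is a bijection on nodes such that $u$ is a child of $v$ iff $\phi(u)$ is a child of $\phi(v)$. It is a tree ciphering if the relation $\{(\overline{u},\overline{\phi(u)}):u\in T_1\}\subset \mathrm{attr}(T_1)\times\mathrm{attr}(T_2)$ is the graph of a bijection $f_\phi:\mathrm{attr}(T_1)\to\mathrm{attr}(T_2)$ (the cipher), i.e. $\overline{\phi(u)}=f_\phi(\overline{u})$ for all $u$. Write $T_1\sim T_2$ if a tree ciphering exists; this is an equivalence relation, and $[u]_\sim$ denotes the equivalence class of $T(u)$. -}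

module Defs where

open import Data.Nat using (ℕ)
open import Data.Fin using (Fin)
open import Data.Maybe using (Maybe; just; nothing)
open import Data.Product using (Σ; ∃; _×_; _,_)
open import Relation.Binary.PropositionalEquality using (_≡_)
open import Relation.Binary.Construct.Closure.ReflexiveTransitive using (Star)
open import Relation.Binary.Construct.Closure.Transitive using (TransClosure)
open import Relation.Nullary using (¬_)
open import Function.Definitions using (Injective)
open import Function.Bundles using (_⇔_)

-- Nodes are Fin size; parent x ≡ just p means x is a child of p.
-- The root has no parent; every node is a descendant of the root
-- (so every non-root node has exactly one parent and there are no cycles).
record LTree (L : Set) : Set where
  field
    size   : ℕ
    root   : Fin size
    parent : Fin size → Maybe (Fin size)
    label  : Fin size → L

  ChildOf : Fin size → Fin size → Set
  ChildOf x p = parent x ≡ just p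

  _⟶_ : Fin size → Fin size → Set
  p ⟶ x = ChildOf x p

  InSub : Fin size → Fin size → Set
  InSub u x = Star _⟶_ u x

  field
    root-noparent : parent root ≡ nothing
    rooted        : ∀ x → InSub root x

open LTree public

-- A tree ciphering between the labelled subtrees T(u) and T(v) of T:
-- a bijection φ : T(u) → T(v) (inverse ψ) preserving and reflecting the
-- child relation, together with a cipher f whose restriction to
-- attr(T(u)) is a bijection onto attr(T(v)) with label(φ x) = f(label x).
record Ciphering {L : Set} (T : LTree L) (u v : Fin (size T)) : Set where
  field
    φ ψ     : Fin (size T) → Fin (size T)
    φ-into  : ∀ x → InSub T u x → InSub T v (φ x)
    ψ-into  : ∀ y → InSub T v y → InSub T u (ψ y)
    ψφ      : ∀ x → InSub T u x → ψ (φ x) ≡ x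
    φψ      : ∀ y → InSub T v y → φ (ψ y) ≡ y
    iso     : ∀ x y → InSub T u x → InSub T u y →
              (ChildOf T x y ⇔ ChildOf T (φ x) (φ y))
    f       : L → L
    cipher  : ∀ x → InSub T u x → label T (φ x) ≡ f (label T x)
    f-inj   : ∀ x y → InSub T u x → InSub T u y →
              f (label T x) ≡ f (label T y) → label T x ≡ label T y
    f-surj  : ∀ y → InSub T v y → ∃ λ x → InSub T u x × f (label T x) ≡ label T y

Sim : {L : Set} (T : LTree L) → Fin (size T) → Fin (size T) → Set
Sim T u v = Ciphering T u v

MultAtLeast : {L : Set} (T : LTree L) → Fin (size T) → Fin (size T) → ℕ → Set
MultAtLeast T p q k =
  ∃ λ u → Sim T u p × Σ (Fin k → Fin (size T)) λ vs →
    Injective _≡_ _≡_ vs × (∀ i → ChildOf T (vs i) u × Sim T (vs i) q)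

-- ([p],[q]) is an edge of G (multiplicity ≥ 1); vertices [p] are represented
-- by nodes p of T.
Edge : {L : Set} (T : LTree L) → Fin (size T) → Fin (size T) → Set
Edge T p q = MultAtLeast T p q 1

-- G has no directed cycle (a cycle through [p] is a nonempty edge path
-- from p to a node equivalent to p; Edge is ∼-invariant, so ending at p suffices).
Acyclic : {L : Set} → LTree L → Set
Acyclic T = ∀ p → ¬ TransClosure (Edge T) p p

Source : {L : Set} (T : LTree L) → Fin (size T) → Set
Source T s = ∀ p → ¬ Edge T p s

UniqueSource : {L : Set} → LTree L → Set
UniqueSource T = ∃ λ s → Source T s × (∀ s′ → Source T s′ → Sim T s′ s)

-- The parent-to-child relation of a finite rooted tree is well founded, so
-- downward paths never revisit a node and are shorter than the tree.  An edge
-- ([p],[q]) puts a child v ∼ q below a node u ∼ p, and a ciphering maps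
-- downward paths of T(v) into T(q) and back; hence the height of T(p) exceeds
-- that of T(q), and a cycle in G would give T(p) unbounded height.  The root
-- is a source: a ciphering T(v) ∼ T(root) with v a child of u would inject the
-- whole tree into T(v), which misses u.  Any other node s has a parent c, and
-- ([c],[s]) is an edge.
module Submission where

open import Defs
open import Level using (Level; _⊔_)
open import Data.Product using (_×_; _,_; ∃; ∃₂)
open import Data.Nat using (ℕ; zero; suc; _+_; _≤_; _<_; s≤s; z≤n)
open import Data.Nat.Properties using (≤-trans; m≤n+m; n≤1+n; n<1+n; <⇒≱; ≰⇒>)
open import Data.Fin as Fin using (Fin; punchOut) renaming (zero to fzero; suc to fsuc)
open import Data.Fin.Properties using (pigeonhole; punchOut-injective; <⇒notInjective; _≟_)
open import Data.Maybe.Properties using (just-injective)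
open import Function.Base using (flip; _∘_)
open import Function.Bundles using (Equivalence; mk⇔)
open import Function.Definitions using (Injective)
open import Induction.WellFounded using (Acc; acc; WellFounded; wf⇒asym)
open import Relation.Binary.Core using (Rel)
open import Relation.Binary.PropositionalEquality using (_≡_; _≢_; refl; sym; trans; cong; subst; subst₂)
open import Relation.Binary.Construct.Closure.ReflexiveTransitive using (Star; ε; _◅_; _◅◅_; reverse)
open import Relation.Binary.Construct.Closure.Transitive as Plus using (TransClosure; [_]; _∷_)
open import Relation.Nullary using (¬_; yes; no; contradiction)

private
  variable
    a ℓ : Level
    A : Set a
    m n : ℕ

data Path {A : Set a} (R : Rel A ℓ) : A → A → ℕ → Set (a ⊔ ℓ) where
  []  : ∀ {x} → Path R x x 0
  _∷_ : ∀ {x y z n} → R x y → Path R y z n → Path R x z (suc n)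

module _ {R : Rel A ℓ} where

  _++_ : ∀ {x y z} → Path R x y m → Path R y z n → Path R x z (m + n)
  []      ++ q = q
  (r ∷ p) ++ q = r ∷ (p ++ q)

  fromStar : ∀ {x y} → Star R x y → ∃ (Path R x y)
  fromStar ε        = 0 , []
  fromStar (r ◅ rs) with fromStar rs
  ... | n , p = suc n , r ∷ p

  _◅⁺_ : ∀ {x y z} → R x y → Star R y z → TransClosure R x z
  r ◅⁺ ε         = [ r ]
  r ◅⁺ (r′ ◅ rs) = r ∷ (r′ ◅⁺ rs)

  lookup : ∀ {x y} → Path R x y n → Fin (suc n) → A
  lookup {x = x} p       fzero    = x
  lookup         (r ∷ p) (fsuc i) = lookup p i

  prefix⁺ : ∀ {x y} (p : Path R x y n) (j : Fin n) → TransClosure R x (lookup p (fsuc j))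
  prefix⁺ (r ∷ p) fzero    = [ r ]
  prefix⁺ (r ∷ p) (fsuc j) = r ∷ prefix⁺ p j

  segment : ∀ {x y} (p : Path R x y n) {i j : Fin (suc n)} →
            i Fin.< j → TransClosure R (lookup p i) (lookup p j)
  segment (r ∷ p) {fzero}  {fsuc j} _         = prefix⁺ (r ∷ p) j
  segment (r ∷ p) {fsuc i} {fsuc j} (s≤s i<j) = segment p i<j

wellFounded⇒⁺-irreflexive : {R : Rel A ℓ} → WellFounded R → ∀ {x} → ¬ TransClosure R x x
wellFounded⇒⁺-irreflexive {R = R} wf r⁺ = wf⇒asym (Plus.wellFounded R wf) r⁺ r⁺

wellFounded⇒path-length< : {R : Rel (Fin m) ℓ} → WellFounded R →
                           ∀ {x y} → Path R x y n → n < m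
wellFounded⇒path-length< {R = R} wf p = ≰⇒> λ m≤n →
  let i , j , i<j , pᵢ≡pⱼ = pigeonhole (s≤s m≤n) (lookup p)
  in wellFounded⇒⁺-irreflexive wf
       (subst (TransClosure R (lookup p i)) (sym pᵢ≡pⱼ) (segment p i<j))

injective⇒¬avoids : ∀ {f : Fin n → Fin n} → Injective _≡_ _≡_ f → ∀ u → ¬ (∀ x → f x ≢ u)
injective⇒¬avoids {suc n} f-inj u f≢u =
  <⇒notInjective {f = λ x → punchOut (f≢u x ∘ sym)} (n<1+n n)
    (f-inj ∘ punchOut-injective (f≢u _ ∘ sym) (f≢u _ ∘ sym))

module _ {L : Set} (T : LTree L) where

  private
    Node : Set
    Node = Fin (size T)

  open LTree T using () renaming (_⟶_ to _⟶ᵗ_)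

  unique-parent : ∀ {u c x} → u ⟶ᵗ x → c ⟶ᵗ x → u ≡ c
  unique-parent u⟶x c⟶x = just-injective (trans (sym u⟶x) c⟶x)

  -- Accessibility descends along child edges because a child has only one parent.
  ⟶-wellFounded : WellFounded _⟶ᵗ_
  ⟶-wellFounded x = descend root-accessible (rooted T x)
    where
    root-accessible : Acc _⟶ᵗ_ (root T)
    root-accessible = acc λ c⟶root → contradiction (trans (sym (root-noparent T)) c⟶root) λ ()

    descend : ∀ {u x} → Acc _⟶ᵗ_ u → InSub T u x → Acc _⟶ᵗ_ x
    descend acc[u] ε            = acc[u]
    descend acc[u] (u⟶y ◅ y⟶*x) =
      descend (acc λ c⟶y → subst (Acc _⟶ᵗ_) (unique-parent u⟶y c⟶y) acc[u]) y⟶*x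

  path-length< : ∀ {x y} → Path _⟶ᵗ_ x y n → n < size T
  path-length< = wellFounded⇒path-length< ⟶-wellFounded

  parent-of-nonroot : ∀ {x} → x ≢ root T → ∃ λ c → c ⟶ᵗ x
  parent-of-nonroot {x} x≢root with reverse {U = flip _⟶ᵗ_} (λ r → r) (rooted T x)
  ... | ε         = contradiction refl x≢root
  ... | c⟶x ◅ _ = _ , c⟶x

  -- A ciphering stripped of its labels and inverse: all that is needed to move downward paths.
  record SubtreeHom (u v : Node) : Set where
    field
      hom   : Node → Node
      into  : ∀ {x} → InSub T u x → InSub T v (hom x)
      child : ∀ {x y} → InSub T u x → x ⟶ᵗ y → hom x ⟶ᵗ hom y

    map-path : ∀ {x y} → InSub T u x → Path _⟶ᵗ_ x y n → Path _⟶ᵗ_ (hom x) (hom y) n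
    map-path u⟶*x []            = []
    map-path u⟶*x (x⟶y ∷ y⟶*z) = child u⟶*x x⟶y ∷ map-path (u⟶*x ◅◅ (x⟶y ◅ ε)) y⟶*z

  module _ {u v : Node} (u∼v : Sim T u v) where
    open Ciphering u∼v

    ciphering-hom : SubtreeHom u v
    ciphering-hom = record
      { hom   = φ
      ; into  = φ-into _
      ; child = λ u⟶*x x⟶y → Equivalence.to (iso _ _ (u⟶*x ◅◅ (x⟶y ◅ ε)) u⟶*x) x⟶y
      }

    ciphering-hom⁻ : SubtreeHom v u
    ciphering-hom⁻ = record
      { hom   = ψ
      ; into  = ψ-into _
      ; child = λ {x} {y} v⟶*x x⟶y →
          let v⟶*y = v⟶*x ◅◅ (x⟶y ◅ ε)
          in Equivalence.from (iso _ _ (ψ-into y v⟶*y) (ψ-into x v⟶*x))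
               (subst₂ _⟶ᵗ_ (sym (φψ x v⟶*x)) (sym (φψ y v⟶*y)) x⟶y)
      }

  HeightAtLeast : Node → ℕ → Set
  HeightAtLeast p k = ∃₂ λ b n → k ≤ n × Path _⟶ᵗ_ p b n

  hom-height : ∀ {u v k} → SubtreeHom u v → HeightAtLeast u k → HeightAtLeast v k
  hom-height h (b , n , k≤n , u⟶ⁿb) =
    let m , v⟶ᵐhu = fromStar (into ε)
    in hom b , m + n , ≤-trans k≤n (m≤n+m n m) , v⟶ᵐhu ++ map-path ε u⟶ⁿb
    where open SubtreeHom h

  parent-height : ∀ {u v k} → u ⟶ᵗ v → HeightAtLeast v k → HeightAtLeast u (suc k)
  parent-height u⟶v (b , n , k≤n , v⟶ⁿb) = b , suc n , s≤s k≤n , u⟶v ∷ v⟶ⁿb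

  height-pred : ∀ {p k} → HeightAtLeast p (suc k) → HeightAtLeast p k
  height-pred (b , n , k<n , p⟶ⁿb) = b , n , ≤-trans (n≤1+n _) k<n , p⟶ⁿb

  height<size : ∀ {p} → ¬ HeightAtLeast p (size T)
  height<size (_ , _ , size≤n , p⟶ⁿb) = <⇒≱ (path-length< p⟶ⁿb) size≤n

  edge-height : ∀ {p q k} → Edge T p q → HeightAtLeast q k → HeightAtLeast p (suc k)
  edge-height (u , u∼p , vs , _ , child∼q) hq =
    let u⟶v , v∼q = child∼q fzero
    in hom-height (ciphering-hom u∼p) (parent-height u⟶v (hom-height (ciphering-hom⁻ v∼q) hq))

  edge⁺-height : ∀ {p q k} → TransClosure (Edge T) p q → HeightAtLeast q k → HeightAtLeast p (suc k)
  edge⁺-height [ p→q ]      hq = edge-height p→q hq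
  edge⁺-height (p→r ∷ r→⁺q) hq = edge-height p→r (height-pred (edge⁺-height r→⁺q hq))

  cycle-height : ∀ {p} → TransClosure (Edge T) p p → ∀ k → HeightAtLeast p k
  cycle-height {p} _    zero    = p , 0 , z≤n , []
  cycle-height     p→⁺p (suc k) = edge⁺-height p→⁺p (cycle-height p→⁺p k)

  acyclic : Acyclic T
  acyclic p p→⁺p = height<size (cycle-height p→⁺p (size T))

  Sim-refl : ∀ x → Sim T x x
  Sim-refl x = record
    { φ = λ y → y ; ψ = λ y → y
    ; φ-into = λ _ s → s ; ψ-into = λ _ s → s
    ; ψφ = λ _ _ → refl ; φψ = λ _ _ → refl
    ; iso = λ _ _ _ _ → mk⇔ (λ r → r) (λ r → r)
    ; f = λ l → l
    ; cipher = λ _ _ → refl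
    ; f-inj = λ _ _ _ _ e → e
    ; f-surj = λ y s → y , s , refl
    }

  parent-edge : ∀ {c x} → c ⟶ᵗ x → Edge T c x
  parent-edge {c} {x} c⟶x =
    c , Sim-refl c , (λ _ → x) , (λ { {fzero} {fzero} _ → refl }) , λ _ → c⟶x , Sim-refl x

  root-source : Source T (root T)
  root-source _ (u , _ , vs , _ , child∼root) =
    let u⟶v , v∼root = child∼root fzero
        open Ciphering v∼root
        ψ-injective : Injective _≡_ _≡_ ψ
        ψ-injective {x} {y} ψx≡ψy =
          trans (sym (φψ x (rooted T x))) (trans (cong φ ψx≡ψy) (φψ y (rooted T y)))
        ψ≢u : ∀ x → ψ x ≢ u
        ψ≢u x ψx≡u = wellFounded⇒⁺-irreflexive ⟶-wellFounded
          (u⟶v ◅⁺ subst (InSub T (vs fzero)) ψx≡u (ψ-into x (rooted T x)))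
    in injective⇒¬avoids ψ-injective u ψ≢u

  source⇒root : ∀ {s} → Source T s → s ≡ root T
  source⇒root {s} s-source with s ≟ root T
  ... | yes s≡root = s≡root
  ... | no  s≢root = let c , c⟶s = parent-of-nonroot s≢root in
                     contradiction (parent-edge c⟶s) (s-source c)

  unique-source : UniqueSource T
  unique-source = root T , root-source , λ s s-source →
    subst (λ x → Sim T x (root T)) (sym (source⇒root s-source)) (Sim-refl (root T))

lemma2 : {L : Set} (T : LTree L) → Acyclic T × UniqueSource T
lemma2 T = acyclic T , unique-source T
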